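{- Let $P\in[0,1]^{n\times n}$ be a stochastic matrix with rational entries, let $S\subset V$ be the set of recurrent states of the Markov chain with transition matrix $P$, and suppose $|S|\ge 2$. Let $Q\in\{D_T, M^{n-2}\}$ and let $E'\subset E$ be such that $(V,E')$ is a rooted forest whose set of roots is exactly $S$. Then $p(E')\,Q$ is a natural number.
   Context: $V=\{1,\dots,n\}$ and $E=\{(v,w):P_{vw}>0\}$ (loops allowed). For $E'\subset E$, $p(E')\coloneqq\prod_{(v,w)\in E'}P_{vw}$. $(V,E')$ is a rooted forest if it has no directed cycles (loops count as cycles) and every vertex has at most one outgoing edge; its roots are the vertices with no outgoing edge. $M_i$ is the lowest common denominator of the entries of row $i$ of $P$, $M$ that of all entries of $P$; $T=V\setminus S$ is the set of transient states and $D_T\coloneqq\prod_{i\in T}M_i$. -}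

module Defs where

open import Data.Nat as ℕ using (ℕ; zero; suc)
open import Data.Nat.LCM using (lcm)
open import Data.Fin using (Fin; zero; suc)
open import Data.Bool using (Bool; true; false; if_then_else_)
open import Data.Rational as ℚ using (ℚ; 0ℚ; 1ℚ; _+_; _*_; _<_; _≤_; ↧ₙ_)
open import Data.Product using (Σ; _×_; _,_)
open import Relation.Binary.PropositionalEquality using (_≡_)
open import Relation.Nullary using (¬_)
open import Relation.Binary.Construct.Closure.ReflexiveTransitive using (Star)
open import Relation.Binary.Construct.Closure.Transitive using (TransClosure)

sumℚ : ∀ {n} → (Fin n → ℚ) → ℚ
sumℚ {zero}  f = 0ℚ
sumℚ {suc n} f = f zero + sumℚ (λ i → f (suc i))

prodℚ : ∀ {n} → (Fin n → ℚ) → ℚ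
prodℚ {zero}  f = 1ℚ
prodℚ {suc n} f = f zero * prodℚ (λ i → f (suc i))

prodℕ : ∀ {n} → (Fin n → ℕ) → ℕ
prodℕ {zero}  f = 1
prodℕ {suc n} f = f zero ℕ.* prodℕ (λ i → f (suc i))

lcmℕ : ∀ {n} → (Fin n → ℕ) → ℕ
lcmℕ {zero}  f = 1
lcmℕ {suc n} f = lcm (f zero) (lcmℕ (λ i → f (suc i)))

Matrix : ℕ → Set
Matrix n = Fin n → Fin n → ℚ

-- P is stochastic: nonnegative entries, rows summing to 1 (entries ≤ 1 follows)
Stochastic : ∀ {n} → Matrix n → Set
Stochastic {n} P = (∀ i j → 0ℚ ≤ P i j) × (∀ i → sumℚ (P i) ≡ 1ℚ)

Edge : ∀ {n} → Matrix n → Fin n → Fin n → Set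
Edge P v w = 0ℚ < P v w

Reach : ∀ {n} → Matrix n → Fin n → Fin n → Set
Reach P = Star (Edge P)

-- recurrent state of a finite Markov chain: every state reachable from i leads back to i
Recurrent : ∀ {n} → Matrix n → Fin n → Set
Recurrent P i = ∀ j → Reach P i j → Reach P j i

Mrow : ∀ {n} → Matrix n → Fin n → ℕ
Mrow P i = lcmℕ (λ j → ↧ₙ (P i j))

Mall : ∀ {n} → Matrix n → ℕ
Mall P = lcmℕ (λ i → lcmℕ (λ j → ↧ₙ (P i j)))

-- D_T = ∏_{i ∈ T} M_i where T = complement of S (S given as a Boolean subset)
DT : ∀ {n} → Matrix n → (Fin n → Bool) → ℕ
DT P S = prodℕ (λ i → if S i then 1 else Mrow P i)

EdgeSet : ℕ → Set
EdgeSet n = Fin n → Fin n → Bool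

InE' : ∀ {n} → EdgeSet n → Fin n → Fin n → Set
InE' E' v w = E' v w ≡ true

SubsetOfE : ∀ {n} → Matrix n → EdgeSet n → Set
SubsetOfE P E' = ∀ v w → InE' E' v w → Edge P v w

pE : ∀ {n} → Matrix n → EdgeSet n → ℚ
pE P E' = prodℚ (λ v → prodℚ (λ w → if E' v w then P v w else 1ℚ))

-- (V,E') is a rooted forest: no directed cycles (loops count), ≤ 1 outgoing edge per vertex
RootedForest : ∀ {n} → EdgeSet n → Set
RootedForest {n} E' =
  (∀ v → ¬ TransClosure (InE' E') v v) ×
  (∀ v w w' → InE' E' v w → InE' E' v w' → w ≡ w')

IsRoot : ∀ {n} → EdgeSet n → Fin n → Set
IsRoot {n} E' v = ∀ w → ¬ InE' E' v w

{-# OPTIONS --safe #-}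
module Submission where

-- A vertex has at most one outgoing edge in a rooted forest, and none if it
-- is a root, i.e. recurrent.  Hence p(E') is a product over the transient
-- vertices v of factors that are either 1 or a single nonnegative entry P v w,
-- whose denominator divides both M_v and M.  Multiplying each factor by M_v
-- (resp. M) gives a natural number, so p(E') D_T ∈ ℕ and p(E') M^|T| ∈ ℕ;
-- finally M^|T| divides M^(n-2) because |S| ≥ 2.

open import Defs
open import Data.Nat using (ℕ; _∸_; _^_)
open import Data.Fin using (Fin)
open import Data.Bool using (Bool; true)
open import Data.Rational using (ℚ; _*_; _/_)
open import Data.Integer using (+_)
open import Data.Product using (Σ; _×_; _,_)
open import Data.Sum using (_⊎_)
open import Function.Bundles using (_⇔_)
open import Relation.Binary.PropositionalEquality using (_≡_; _≢_)

open import Algebra.Bundles using (CommutativeMonoid)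
import Algebra.Properties.CommutativeSemigroup as CommutativeSemigroupProperties
open import Data.Bool using (false; if_then_else_)
open import Data.Empty using (⊥-elim)
open import Data.Fin using (zero; suc)
open import Data.Fin.Properties using (0≢1+n; suc-injective)
open import Data.Fin.Subset using (Subset; ∁; ∣_∣; _∈_; _-_)
open import Data.Fin.Subset.Properties using (∣∁p∣≡n∸∣p∣; x∈p⇒∣p-x∣<∣p∣; x∈p∧x≢y⇒x∈p-y)
open import Data.Integer as ℤ using (-[1+_])
import Data.Integer.Properties as ℤ
open import Data.Nat as ℕ using (zero; suc; s≤s; z≤n)
open import Data.Nat.Divisibility using (_∣_; divides; ∣-trans)
open import Data.Nat.LCM using (m∣lcm[m,n]; n∣lcm[m,n])
import Data.Nat.Properties as ℕ
open import Data.Product using (∃)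
open import Data.Rational as ℚ using (mkℚ; 0ℚ; 1ℚ; _≤_; ↥_; ↧_; ↧ₙ_; toℚᵘ)
import Data.Rational.Properties as ℚ
open import Data.Rational.Unnormalised as ℚᵘ using (mkℚᵘ; *≡*) renaming (_≃_ to _≃ᵘ_)
import Data.Rational.Unnormalised.Properties as ℚᵘ
open import Data.Sum using (inj₁; inj₂)
open import Data.Vec using (tabulate)
open import Data.Vec.Properties using (lookup⇒[]=; lookup∘tabulate)
open import Function.Bundles using (module Equivalence)
open import Relation.Binary.PropositionalEquality using (refl; sym; trans; cong; module ≡-Reasoning)

IsNatural : ℚ → Set
IsNatural q = Σ ℕ λ k → q ≡ + k / 1

toℚᵘ-/1 : ∀ i → toℚᵘ (i / 1) ≃ᵘ mkℚᵘ i 0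
toℚᵘ-/1 i = ℚ.toℚᵘ-fromℚᵘ (mkℚᵘ i 0)

/1-homo-* : ∀ i j → (i / 1) * (j / 1) ≡ (i ℤ.* j) / 1
/1-homo-* i j = ℚ.toℚᵘ-injective (begin
  toℚᵘ ((i / 1) * (j / 1))       ≈⟨ ℚ.toℚᵘ-homo-* (i / 1) (j / 1) ⟩
  toℚᵘ (i / 1) ℚᵘ.* toℚᵘ (j / 1) ≈⟨ ℚᵘ.*-cong (toℚᵘ-/1 i) (toℚᵘ-/1 j) ⟩
  mkℚᵘ (i ℤ.* j) 0               ≈⟨ toℚᵘ-/1 (i ℤ.* j) ⟨
  toℚᵘ ((i ℤ.* j) / 1)           ∎)
  where open ℚᵘ.≃-Reasoning

+/1-homo-* : ∀ a b → (+ a / 1) * (+ b / 1) ≡ + (a ℕ.* b) / 1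
+/1-homo-* a b = trans (/1-homo-* (+ a) (+ b)) (cong (_/ 1) (sym (ℤ.pos-* a b)))

*-↧/1 : ∀ p → p * (↧ p / 1) ≡ ↥ p / 1
*-↧/1 p@(mkℚ a d _) = ℚ.toℚᵘ-injective (begin
  toℚᵘ (p * (↧ p / 1))              ≈⟨ ℚ.toℚᵘ-homo-* p (↧ p / 1) ⟩
  toℚᵘ p ℚᵘ.* toℚᵘ (↧ p / 1)        ≈⟨ ℚᵘ.*-congˡ {toℚᵘ p} (toℚᵘ-/1 (↧ p)) ⟩
  toℚᵘ p ℚᵘ.* mkℚᵘ (↧ p) 0          ≈⟨ *≡* cross-multiplied ⟩
  mkℚᵘ a 0                          ≈⟨ toℚᵘ-/1 a ⟨
  toℚᵘ (a / 1)                      ∎)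
  where
  open ℚᵘ.≃-Reasoning
  cross-multiplied : (a ℤ.* + suc d) ℤ.* + 1 ≡ a ℤ.* + suc (d ℕ.* 1)
  cross-multiplied rewrite ℕ.*-identityʳ d = ℤ.*-identityʳ (a ℤ.* + suc d)

isNatural-* : ∀ {p q} → IsNatural p → IsNatural q → IsNatural (p * q)
isNatural-* (a , refl) (b , refl) = a ℕ.* b , +/1-homo-* a b

isNatural-prodℚ : ∀ {m} {f : Fin m → ℚ} → (∀ i → IsNatural (f i)) → IsNatural (prodℚ f)
isNatural-prodℚ {zero}  f-nat = 1 , refl
isNatural-prodℚ {suc m} f-nat = isNatural-* (f-nat zero) (isNatural-prodℚ (λ i → f-nat (suc i)))

isNatural-*-∣ : ∀ {q a b} → IsNatural (q * (+ a / 1)) → a ∣ b → IsNatural (q * (+ b / 1))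
isNatural-*-∣ {q} {a} (k , qa≡k) (divides c refl) = k ℕ.* c , (begin
  q * (+ (c ℕ.* a) / 1)           ≡⟨ cong (λ x → q * (+ x / 1)) (ℕ.*-comm c a) ⟩
  q * (+ (a ℕ.* c) / 1)           ≡⟨ cong (q *_) (+/1-homo-* a c) ⟨
  q * ((+ a / 1) * (+ c / 1))     ≡⟨ ℚ.*-assoc q (+ a / 1) (+ c / 1) ⟨
  (q * (+ a / 1)) * (+ c / 1)     ≡⟨ cong (_* (+ c / 1)) qa≡k ⟩
  (+ k / 1) * (+ c / 1)           ≡⟨ +/1-homo-* k c ⟩
  + (k ℕ.* c) / 1                 ∎)
  where open ≡-Reasoning

isNatural-*-↧ : ∀ {p} → 0ℚ ≤ p → IsNatural (p * (+ ↧ₙ p / 1))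
isNatural-*-↧ {mkℚ (+ a)    d _} _ = a , *-↧/1 (mkℚ (+ a) d _)
isNatural-*-↧ {mkℚ -[1+ a ] d _} (ℚ.*≤* ())

prodℚ-*-prodℕ : ∀ {m} (f : Fin m → ℚ) (g : Fin m → ℕ) →
  prodℚ f * (+ prodℕ g / 1) ≡ prodℚ (λ i → f i * (+ g i / 1))
prodℚ-*-prodℕ {zero}  f g = refl
prodℚ-*-prodℕ {suc m} f g = begin
  (f zero * F) * (+ (g zero ℕ.* G) / 1)         ≡⟨ cong ((f zero * F) *_) (+/1-homo-* (g zero) G) ⟨
  (f zero * F) * ((+ g zero / 1) * (+ G / 1))   ≡⟨ interchange (f zero) F (+ g zero / 1) (+ G / 1) ⟩
  (f zero * (+ g zero / 1)) * (F * (+ G / 1))   ≡⟨ cong ((f zero * (+ g zero / 1)) *_)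
                                                        (prodℚ-*-prodℕ (λ i → f (suc i)) (λ i → g (suc i))) ⟩
  prodℚ (λ i → f i * (+ g i / 1))               ∎
  where
  open ≡-Reasoning
  open CommutativeSemigroupProperties (CommutativeMonoid.commutativeSemigroup ℚ.*-1-commutativeMonoid)
  F : ℚ
  F = prodℚ (λ i → f (suc i))
  G : ℕ
  G = prodℕ (λ i → g (suc i))

prodℚ-if-none : ∀ {m} (f : Fin m → Bool) (p : Fin m → ℚ) →
  (∀ w → f w ≢ true) → prodℚ (λ w → if f w then p w else 1ℚ) ≡ 1ℚ
prodℚ-if-none {zero}  f p none = refl
prodℚ-if-none {suc m} f p none with f zero in f0
... | true  = ⊥-elim (none zero f0)
... | false = trans (ℚ.*-identityˡ _)
                (prodℚ-if-none (λ w → f (suc w)) (λ w → p (suc w)) (λ w → none (suc w)))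

prodℚ-if-unique : ∀ {m} (f : Fin m → Bool) (p : Fin m → ℚ) →
  (∀ w w' → f w ≡ true → f w' ≡ true → w ≡ w') →
  prodℚ (λ w → if f w then p w else 1ℚ) ≡ 1ℚ ⊎ ∃ λ w → prodℚ (λ w → if f w then p w else 1ℚ) ≡ p w
prodℚ-if-unique {zero}  f p unique = inj₁ refl
prodℚ-if-unique {suc m} f p unique with f zero in f0
... | true  = inj₂ (zero , trans (cong (p zero *_) rest≡1) (ℚ.*-identityʳ (p zero)))
  where
  rest≡1 : prodℚ (λ w → if f (suc w) then p (suc w) else 1ℚ) ≡ 1ℚ
  rest≡1 = prodℚ-if-none (λ w → f (suc w)) (λ w → p (suc w))
             (λ w fw → 0≢1+n (unique zero (suc w) f0 fw))
... | false with prodℚ-if-unique (λ w → f (suc w)) (λ w → p (suc w))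
                   (λ w w' fw fw' → suc-injective (unique (suc w) (suc w') fw fw'))
...   | inj₁ rest≡1       = inj₁ (trans (ℚ.*-identityˡ _) rest≡1)
...   | inj₂ (w , rest≡p) = inj₂ (suc w , trans (ℚ.*-identityˡ _) rest≡p)

isNatural-prodℚ-if-* : ∀ {m} (f : Fin m → Bool) (p : Fin m → ℚ) {g} →
  (∀ w → 0ℚ ≤ p w) → (∀ w → ↧ₙ p w ∣ g) → (∀ w w' → f w ≡ true → f w' ≡ true → w ≡ w') →
  IsNatural (prodℚ (λ w → if f w then p w else 1ℚ) * (+ g / 1))
isNatural-prodℚ-if-* f p {g} p≥0 ↧p∣g unique with prodℚ-if-unique f p unique
... | inj₁ prod≡1       rewrite prod≡1 = g , ℚ.*-identityˡ (+ g / 1)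
... | inj₂ (w , prod≡p) rewrite prod≡p = isNatural-*-∣ {p w} (isNatural-*-↧ (p≥0 w)) (↧p∣g w)

isNatural-pE-* : ∀ {n} (P : Matrix n) (E' : EdgeSet n) (S : Fin n → Bool) (G : Fin n → ℕ) →
  (∀ v w → 0ℚ ≤ P v w) → (∀ v w → ↧ₙ P v w ∣ G v) →
  (∀ v w w' → InE' E' v w → InE' E' v w' → w ≡ w') → (∀ v → S v ≡ true → IsRoot E' v) →
  IsNatural (pE P E' * (+ prodℕ (λ v → if S v then 1 else G v) / 1))
isNatural-pE-* P E' S G P≥0 ↧P∣G functional S⇒root
  rewrite prodℚ-*-prodℕ (λ v → prodℚ (λ w → if E' v w then P v w else 1ℚ)) (λ v → if S v then 1 else G v)
  = isNatural-prodℚ row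
  where
  row : ∀ v → IsNatural (prodℚ (λ w → if E' v w then P v w else 1ℚ) * (+ (if S v then 1 else G v) / 1))
  row v with S v in Sv
  ... | true  rewrite prodℚ-if-none (E' v) (P v) (S⇒root v Sv) = 1 , refl
  ... | false = isNatural-prodℚ-if-* (E' v) (P v) (P≥0 v) (↧P∣G v) (functional v)

∣-lcmℕ : ∀ {m} (f : Fin m → ℕ) i → f i ∣ lcmℕ f
∣-lcmℕ f zero    = m∣lcm[m,n] (f zero) _
∣-lcmℕ f (suc i) = ∣-trans (∣-lcmℕ (λ j → f (suc j)) i) (n∣lcm[m,n] (f zero) _)

m^i∣m^j : ∀ m {i j} → i ℕ.≤ j → m ^ i ∣ m ^ j
m^i∣m^j m {i} {j} i≤j = divides (m ^ (j ∸ i)) (begin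
  m ^ j                 ≡⟨ cong (m ^_) (ℕ.m+[n∸m]≡n i≤j) ⟨
  m ^ (i ℕ.+ (j ∸ i))   ≡⟨ ℕ.^-distribˡ-+-* m i (j ∸ i) ⟩
  m ^ i ℕ.* m ^ (j ∸ i) ≡⟨ ℕ.*-comm (m ^ i) (m ^ (j ∸ i)) ⟩
  m ^ (j ∸ i) ℕ.* m ^ i ∎)
  where open ≡-Reasoning

x∈p∧y∈p∧x≢y⇒2≤∣p∣ : ∀ {n} {p : Subset n} {x y} → x ∈ p → y ∈ p → x ≢ y → 2 ℕ.≤ ∣ p ∣
x∈p∧y∈p∧x≢y⇒2≤∣p∣ {p = p} {x} {y} x∈p y∈p x≢y =
  ℕ.≤-trans (s≤s (ℕ.≤-trans (s≤s z≤n) ∣p-x-y∣<∣p-x∣)) (x∈p⇒∣p-x∣<∣p∣ x∈p)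
  where
  ∣p-x-y∣<∣p-x∣ : ∣ p - x - y ∣ ℕ.< ∣ p - x ∣
  ∣p-x-y∣<∣p-x∣ = x∈p⇒∣p-x∣<∣p∣ (x∈p∧x≢y⇒x∈p-y y∈p (λ y≡x → x≢y (sym y≡x)))

prodℕ-if-1≡^∣∁∣ : ∀ {n} (S : Fin n → Bool) m →
  prodℕ (λ v → if S v then 1 else m) ≡ m ^ ∣ ∁ (tabulate S) ∣
prodℕ-if-1≡^∣∁∣ {zero}  S m = refl
prodℕ-if-1≡^∣∁∣ {suc n} S m with S zero
... | true  = trans (ℕ.+-identityʳ _) (prodℕ-if-1≡^∣∁∣ (λ v → S (suc v)) m)
... | false = cong (m ℕ.*_) (prodℕ-if-1≡^∣∁∣ (λ v → S (suc v)) m)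

prodℕ-if-1∣^[n∸2] : ∀ {n} (S : Fin n → Bool) m {i j} → i ≢ j → S i ≡ true → S j ≡ true →
  prodℕ (λ v → if S v then 1 else m) ∣ m ^ (n ∸ 2)
prodℕ-if-1∣^[n∸2] {n} S m i≢j Si Sj
  rewrite prodℕ-if-1≡^∣∁∣ S m | ∣∁p∣≡n∸∣p∣ (tabulate S)
  = m^i∣m^j m (ℕ.∸-monoʳ-≤ n (x∈p∧y∈p∧x≢y⇒2≤∣p∣ (∈S Si) (∈S Sj) i≢j))
  where
  ∈S : ∀ {v} → S v ≡ true → v ∈ tabulate S
  ∈S {v} Sv = lookup⇒[]= v (tabulate S) (trans (lookup∘tabulate S v) Sv)

lemma3p4 : (n : ℕ) (P : Matrix n) → Stochastic P →
    (S : Fin n → Bool) → (∀ i → (S i ≡ true) ⇔ Recurrent P i) →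
    Σ (Fin n) (λ i → Σ (Fin n) (λ j → i ≢ j × S i ≡ true × S j ≡ true)) →
    (Q : ℕ) → (Q ≡ DT P S ⊎ Q ≡ Mall P ^ (n ∸ 2)) →
    (E' : EdgeSet n) → SubsetOfE P E' → RootedForest E' →
    (∀ v → IsRoot E' v ⇔ (S v ≡ true)) →
    Σ ℕ (λ k → pE P E' * (+ Q / 1) ≡ (+ k / 1))
lemma3p4 n P (P≥0 , _) S _ _ Q (inj₁ refl) E' _ (_ , functional) roots =
  isNatural-pE-* P E' S (Mrow P) P≥0 (λ v → ∣-lcmℕ _) functional (λ v → Equivalence.from (roots v))
lemma3p4 n P (P≥0 , _) S _ (i , j , i≢j , Si , Sj) Q (inj₂ refl) E' _ (_ , functional) roots =
  isNatural-*-∣ {pE P E'}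
    (isNatural-pE-* P E' S (λ _ → Mall P) P≥0 (λ v w → ∣-trans (∣-lcmℕ _ w) (∣-lcmℕ _ v))
      functional (λ v → Equivalence.from (roots v)))
    (prodℕ-if-1∣^[n∸2] S (Mall P) i≢j Si Sj)
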